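{- A subset $S\subset\mathbb{Z}^n$ is realizable if and only if the following three properties hold: (1) if $x\in S$, then $x_i\ge 0$ for every $i\in\{1,\dots,n\}$, and $x$ has at most one coordinate equal to zero; (2) for every $i\in\{1,\dots,n\}$ there exists exactly one element $x\in S$ with $x_i=0$; (3) if $x\in S$ and $x_i>0$ for some $i\in\{1,\dots,n\}$, then there exists $y\in S$ with $y_i=x_i-1$ and $\max_{j\in\{1,\dots,n\}}\vert y_j-x_j\vert\le 1$.
   Context: All graphs are finite, simple and connected; $d$ is the shortest-path distance. For $x\in\mathbb{Z}^n$, $x_i$ is its $i$-th coordinate. For an ordered vertex subset $W=(\omega_1,\dots,\omega_n)$ of $G$, $r(u\vert W)=(d(u,\omega_1),\dots,d(u,\omega_n))$. $W$ is a resolving set if $r(u\vert W)\ne r(v\vert W)$ for all distinct $u,v\in V(G)$. A finite subset $S\subset\mathbb{Z}^n$ is realizable if there exist a graph $G$ and a resolving set $W$ of $G$ (with $n$ elements) such that $S=\{r(u\vert W)\colon u\in V(G)\}$. -}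

module Defs where

open import Data.Nat using (ℕ; zero; suc; _<_; _≤_)
open import Data.Bool using (Bool; true; false)
open import Data.Fin using (Fin)
open import Data.Integer using (ℤ; +_; _-_; ∣_∣) renaming (_≤_ to _≤ℤ_; _<_ to _<ℤ_)
open import Data.Vec using (Vec; lookup)
open import Data.List using (List)
open import Data.List.Membership.Propositional using (_∈_)
open import Data.Product using (Σ; ∃; _×_; _,_)
open import Relation.Binary.PropositionalEquality using (_≡_)
open import Relation.Nullary using (¬_)
open import Function.Definitions using (Injective)

record Graph (m : ℕ) : Set where
  field
    adj   : Fin m → Fin m → Bool
    sym   : ∀ u v → adj u v ≡ adj v u
    irrefl : ∀ u → adj u u ≡ false

open Graph public

data Walk {m : ℕ} (G : Graph m) : Fin m → Fin m → ℕ → Set where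
  here : ∀ {u} → Walk G u u zero
  step : ∀ {u v w k} → adj G u v ≡ true → Walk G v w k → Walk G u w (suc k)

Connected : ∀ {m} → Graph m → Set
Connected G = ∀ u v → ∃ λ k → Walk G u v k

Dist : ∀ {m} → Graph m → Fin m → Fin m → ℕ → Set
Dist G u v k = Walk G u v k × (∀ j → j < k → ¬ Walk G u v j)

IsRep : ∀ {m n} → Graph m → (Fin n → Fin m) → Fin m → Vec ℤ n → Set
IsRep G W u x = ∀ i → Σ ℕ λ k → (lookup x i ≡ + k) × Dist G u (W i) k

Resolving : ∀ {m n} → Graph m → (Fin n → Fin m) → Set
Resolving {n = n} G W = ∀ u v (x : Vec ℤ n) → IsRep G W u x → IsRep G W v x → u ≡ v

-- S (a finite subset of ℤ^n, given as a list; only membership matters)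
-- is realizable.
Realizable : (n : ℕ) → List (Vec ℤ n) → Set
Realizable n S =
  Σ ℕ λ m → Σ (Graph m) λ G → Σ (Fin n → Fin m) λ W →
    Connected G × Injective _≡_ _≡_ W × Resolving G W ×
    (∀ x → x ∈ S → ∃ λ u → IsRep G W u x) ×
    (∀ u → ∃ λ x → x ∈ S × IsRep G W u x)

Prop1 : (n : ℕ) → List (Vec ℤ n) → Set
Prop1 n S = ∀ x → x ∈ S →
  (∀ i → + 0 ≤ℤ lookup x i) ×
  (∀ i j → lookup x i ≡ + 0 → lookup x j ≡ + 0 → i ≡ j)

Prop2 : (n : ℕ) → List (Vec ℤ n) → Set
Prop2 n S = ∀ i → ∃ λ x → (x ∈ S × lookup x i ≡ + 0) ×
  (∀ y → y ∈ S → lookup y i ≡ + 0 → y ≡ x)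

Prop3 : (n : ℕ) → List (Vec ℤ n) → Set
Prop3 n S = ∀ x i → x ∈ S → + 0 <ℤ lookup x i →
  ∃ λ y → y ∈ S × lookup y i ≡ lookup x i - + 1 ×
    (∀ j → ∣ lookup y j - lookup x j ∣ ≤ 1)

-- Necessity: a vertex at distance k + 1 from ω_i has a neighbour at distance k, and the
-- distances of adjacent vertices to any ω_j differ by at most 1. Sufficiency: take the
-- points of S as vertices and join two of them when they differ by at most 1 in every
-- coordinate. The coordinate x_i is then exactly the distance to the unique point with
-- i-th coordinate 0: property (3) yields a walk of length x_i towards it, and since x_i
-- changes by at most 1 along an edge no walk is shorter.
module Submission where

open import Defs hiding (sym)
open import Data.Nat using (ℕ; zero; suc; _+_; _≤_; z≤n; s≤s; s≤s⁻¹; _≤?_)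
import Data.Nat as ℕ
open import Data.Nat.Properties
  using (≤-refl; ≤-antisym; ≤-trans; ≰⇒>; <⇒≱; +-identityʳ; +-monoˡ-≤; m≤∣m-n∣+n; 1+n≢n)
open import Data.Integer using (ℤ; +_; ∣_∣; _⊖_) renaming (_-_ to _-ℤ_; _≤_ to _≤ℤ_; _<_ to _<ℤ_)
import Data.Integer as ℤ
import Data.Integer.Properties as ℤ
open import Data.Fin using (Fin)
import Data.Fin as Fin
open import Data.Fin.Properties using (all?)
open import Data.Vec using (Vec; lookup; tabulate)
open import Data.Vec.Properties using (tabulate∘lookup; tabulate-cong)
import Data.Vec.Properties as Vec
open import Data.List using (List; length; deduplicate)
import Data.List as List
open import Data.List.Membership.Propositional using (_∈_)
open import Data.List.Membership.Propositional.Properties using (∈-lookup; ∈-deduplicate⁺; ∈-deduplicate⁻)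
open import Data.List.Relation.Unary.Any using (index)
open import Data.List.Relation.Unary.Any.Properties using (lookup-index)
import Data.List.Relation.Unary.All as All
open import Data.List.Relation.Unary.AllPairs using (_∷_)
open import Data.List.Relation.Unary.Unique.Propositional using (Unique)
import Data.List.Relation.Unary.Unique.DecPropositional.Properties as Unique
open import Data.Product using (Σ; ∃; _×_; _,_; proj₁; proj₂)
open import Data.Empty using (⊥-elim)
open import Data.Bool using (true)
open import Function using (_∘_)
open import Function.Bundles using (_⇔_; mk⇔)
open import Function.Definitions using (Injective)
open import Relation.Nullary using (¬_; Dec; yes; no; does; proof; ¬?; _×-dec_)
open import Relation.Nullary.Reflects using (Reflects; invert)
open import Relation.Nullary.Decidable using (dec-true; dec-false; does-⇔)
open import Relation.Binary.PropositionalEquality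

∣m⊖n∣≡∣m-n∣ : ∀ m n → ∣ m ⊖ n ∣ ≡ ℕ.∣ m - n ∣
∣m⊖n∣≡∣m-n∣ zero    zero    = refl
∣m⊖n∣≡∣m-n∣ zero    (suc n) = refl
∣m⊖n∣≡∣m-n∣ (suc m) zero    = refl
∣m⊖n∣≡∣m-n∣ (suc m) (suc n) = trans (cong ∣_∣ (ℤ.[1+m]⊖[1+n]≡m⊖n m n)) (∣m⊖n∣≡∣m-n∣ m n)

∣+m-+n∣≡∣m-n∣ : ∀ m n → ∣ + m -ℤ + n ∣ ≡ ℕ.∣ m - n ∣
∣+m-+n∣≡∣m-n∣ m n = trans (cong ∣_∣ (ℤ.m-n≡m⊖n m n)) (∣m⊖n∣≡∣m-n∣ m n)

m≤1+n∧n≤1+m⇒∣m-n∣≤1 : ∀ {m n} → m ≤ suc n → n ≤ suc m → ℕ.∣ m - n ∣ ≤ 1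
m≤1+n∧n≤1+m⇒∣m-n∣≤1 {zero}        {zero}        _       _       = z≤n
m≤1+n∧n≤1+m⇒∣m-n∣≤1 {zero}        {suc zero}    _       _       = s≤s z≤n
m≤1+n∧n≤1+m⇒∣m-n∣≤1 {zero}        {suc (suc n)} _       (s≤s ())
m≤1+n∧n≤1+m⇒∣m-n∣≤1 {suc zero}    {zero}        _       _       = s≤s z≤n
m≤1+n∧n≤1+m⇒∣m-n∣≤1 {suc (suc m)} {zero}        (s≤s ()) _
m≤1+n∧n≤1+m⇒∣m-n∣≤1 {suc m}       {suc n}       (s≤s p) (s≤s q) = m≤1+n∧n≤1+m⇒∣m-n∣≤1 p q

m≤1+n∧n≤1+m⇒∣+m-+n∣≤1 : ∀ {m n} → m ≤ suc n → n ≤ suc m → ∣ + m -ℤ + n ∣ ≤ 1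
m≤1+n∧n≤1+m⇒∣+m-+n∣≤1 {m} {n} p q =
  subst (_≤ 1) (sym (∣+m-+n∣≡∣m-n∣ m n)) (m≤1+n∧n≤1+m⇒∣m-n∣≤1 p q)

∣+m-+n∣≤1⇒m≤1+n : ∀ m n → ∣ + m -ℤ + n ∣ ≤ 1 → m ≤ suc n
∣+m-+n∣≤1⇒m≤1+n m n p =
  ≤-trans (m≤∣m-n∣+n m n) (+-monoˡ-≤ n (subst (_≤ 1) (∣+m-+n∣≡∣m-n∣ m n) p))

lookup-ext : ∀ {A : Set} {n} {xs ys : Vec A n} → (∀ i → lookup xs i ≡ lookup ys i) → xs ≡ ys
lookup-ext {xs = xs} {ys} eq = begin
  xs                   ≡⟨ tabulate∘lookup xs ⟨
  tabulate (lookup xs) ≡⟨ tabulate-cong eq ⟩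
  tabulate (lookup ys) ≡⟨ tabulate∘lookup ys ⟩
  ys                   ∎
  where open ≡-Reasoning

Unique⇒lookup-injective : ∀ {A : Set} {xs : List A} → Unique xs → Injective _≡_ _≡_ (List.lookup xs)
Unique⇒lookup-injective (_  ∷ _)  {Fin.zero}  {Fin.zero}  _  = refl
Unique⇒lookup-injective (x∉ ∷ _)  {Fin.zero}  {Fin.suc j} eq = ⊥-elim (All.lookup x∉ (∈-lookup j) eq)
Unique⇒lookup-injective (x∉ ∷ _)  {Fin.suc i} {Fin.zero}  eq = ⊥-elim (All.lookup x∉ (∈-lookup i) (sym eq))
Unique⇒lookup-injective (_  ∷ xs!) {Fin.suc i} {Fin.suc j} eq = cong Fin.suc (Unique⇒lookup-injective xs! eq)

Fin-inhabited? : ∀ n → Dec (Fin n)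
Fin-inhabited? zero    = no λ ()
Fin-inhabited? (suc n) = yes Fin.zero

module _ {m : ℕ} (G : Graph m) where

  adj-sym : ∀ {u v} → adj G u v ≡ true → adj G v u ≡ true
  adj-sym {u} {v} e = trans (Graph.sym G v u) e

  Walk-zero⇒≡ : ∀ {u v} → Walk G u v 0 → u ≡ v
  Walk-zero⇒≡ here = refl

  Walk-snoc : ∀ {u v w k} → Walk G u v k → adj G v w ≡ true → Walk G u w (suc k)
  Walk-snoc here         e = step e here
  Walk-snoc (step e′ uv) e = step e′ (Walk-snoc uv e)

  Walk-reverse : ∀ {u v k} → Walk G u v k → Walk G v u k
  Walk-reverse here        = here
  Walk-reverse (step e uv) = Walk-snoc (Walk-reverse uv) (adj-sym e)

  Walk-append : ∀ {u v w a b} → Walk G u v a → Walk G v w b → Walk G u w (a + b)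
  Walk-append here        vw = vw
  Walk-append (step e uv) vw = step e (Walk-append uv vw)

  Walk-lipschitz : (f : Fin m → ℕ) → (∀ {u v} → adj G u v ≡ true → f u ≤ suc (f v)) →
                   ∀ {u v j} → Walk G u v j → f u ≤ j + f v
  Walk-lipschitz f f-adj here        = ≤-refl
  Walk-lipschitz f f-adj (step e uv) = ≤-trans (f-adj e) (s≤s (Walk-lipschitz f f-adj uv))

  connected-via : (c : Fin m) → (∀ u → ∃ λ k → Walk G u c k) → Connected G
  connected-via c reach u v with reach u | reach v
  ... | a , uc | b , vc = a + b , Walk-append uc (Walk-reverse vc)

  Dist⇒≤length : ∀ {u v k j} → Dist G u v k → Walk G u v j → k ≤ j
  Dist⇒≤length {k = k} {j} (_ , shortest) uv with k ≤? j
  ... | yes k≤j = k≤j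
  ... | no  k≰j = ⊥-elim (shortest j (≰⇒> k≰j) uv)

  Dist-intro : ∀ {u v k} → Walk G u v k → (∀ {j} → Walk G u v j → k ≤ j) → Dist G u v k
  Dist-intro uv minimal = uv , λ j j<k uv′ → <⇒≱ j<k (minimal uv′)

  Dist-refl : ∀ {u} → Dist G u u 0
  Dist-refl = Dist-intro here λ _ → z≤n

  Dist-unique : ∀ {u v a b} → Dist G u v a → Dist G u v b → a ≡ b
  Dist-unique da db = ≤-antisym (Dist⇒≤length da (proj₁ db)) (Dist⇒≤length db (proj₁ da))

  Dist-adjacent : ∀ {u v w a b} → adj G u v ≡ true → Dist G u w a → Dist G v w b → a ≤ suc b
  Dist-adjacent e da db = Dist⇒≤length da (step e (proj₁ db))

  Dist-step : ∀ {u w k} → Dist G u w (suc k) → ∃ λ v → adj G u v ≡ true × Dist G v w k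
  Dist-step d@(step {v = v} e vw , _) =
    v , e , Dist-intro vw λ vw′ → s≤s⁻¹ (Dist⇒≤length d (step e vw′))

  module _ {n : ℕ} (W : Fin n → Fin m) where

    IsRep-coordinate : ∀ {u k} x i → IsRep G W u x → Dist G u (W i) k → lookup x i ≡ + k
    IsRep-coordinate x i r d with r i
    ... | _ , xi≡k′ , d′ = trans xi≡k′ (cong +_ (Dist-unique d′ d))

    IsRep-unique : ∀ {u} x y → IsRep G W u x → IsRep G W u y → x ≡ y
    IsRep-unique {u} x y rx ry = lookup-ext λ i → agree i (ry i)
      where
      agree : ∀ i → Σ ℕ (λ k → (lookup y i ≡ + k) × Dist G u (W i) k) → lookup x i ≡ lookup y i
      agree i (_ , yi≡k , d) = trans (IsRep-coordinate x i rx d) (sym yi≡k)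

    IsRep-adjacent : ∀ {u v} x y → adj G u v ≡ true → IsRep G W u x → IsRep G W v y →
                     ∀ j → ∣ lookup y j -ℤ lookup x j ∣ ≤ 1
    IsRep-adjacent x y e rx ry j with ry j | rx j
    ... | a , yj≡a , da | b , xj≡b , db rewrite yj≡a | xj≡b =
      m≤1+n∧n≤1+m⇒∣+m-+n∣≤1 (Dist-adjacent (adj-sym e) da db) (Dist-adjacent e db da)

module Necessity {n m} {S : List (Vec ℤ n)} (G : Graph m) (W : Fin n → Fin m)
  (W-injective : Injective _≡_ _≡_ W)
  (realize : ∀ x → x ∈ S → ∃ λ u → IsRep G W u x)
  (represent : ∀ u → ∃ λ x → x ∈ S × IsRep G W u x) where

  zero-coordinate⇒≡W : ∀ {u} x i → IsRep G W u x → lookup x i ≡ + 0 → u ≡ W i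
  zero-coordinate⇒≡W x i r xi≡0 with r i
  ... | k , xi≡k , (uω , _) with trans (sym xi≡k) xi≡0
  ... | refl = Walk-zero⇒≡ G uω

  prop1 : Prop1 n S
  prop1 x x∈S with realize x x∈S
  ... | u , r = nonnegative , at-most-one-zero
    where
    nonnegative : ∀ i → + 0 ≤ℤ lookup x i
    nonnegative i with r i
    ... | _ , xi≡k , _ = subst (+ 0 ≤ℤ_) (sym xi≡k) (ℤ.+≤+ z≤n)
    at-most-one-zero : ∀ i j → lookup x i ≡ + 0 → lookup x j ≡ + 0 → i ≡ j
    at-most-one-zero i j xi≡0 xj≡0 =
      W-injective (trans (sym (zero-coordinate⇒≡W x i r xi≡0)) (zero-coordinate⇒≡W x j r xj≡0))

  prop2 : Prop2 n S
  prop2 i with represent (W i)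
  ... | x , x∈S , r = x , (x∈S , IsRep-coordinate G W x i r (Dist-refl G)) , unique
    where
    unique : ∀ y → y ∈ S → lookup y i ≡ + 0 → y ≡ x
    unique y y∈S yi≡0 with realize y y∈S
    ... | u , r′ with zero-coordinate⇒≡W y i r′ yi≡0
    ... | refl = IsRep-unique G W y x r′ r

  prop3 : Prop3 n S
  prop3 x i x∈S 0<xi with realize x x∈S
  ... | u , r with r i
  ... | zero , xi≡0 , _ = ⊥-elim (ℤ.<-irrefl refl (subst (+ 0 <ℤ_) xi≡0 0<xi))
  ... | suc k , xi≡1+k , d with Dist-step G d
  ... | v , e , dv with represent v
  ... | y , y∈S , r′ =
    y , y∈S , trans (IsRep-coordinate G W y i r′ dv) (cong (_-ℤ + 1) (sym xi≡1+k)) ,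
    IsRep-adjacent G W x y e r r′

module Sufficiency {n} {S : List (Vec ℤ n)} (prop1 : Prop1 n S) (prop2 : Prop2 n S) (prop3 : Prop3 n S) where

  _≟ᵥ_ : (x y : Vec ℤ n) → Dec (x ≡ y)
  _≟ᵥ_ = Vec.≡-dec ℤ._≟_

  points : List (Vec ℤ n)
  points = deduplicate _≟ᵥ_ S

  m : ℕ
  m = length points

  point : Fin m → Vec ℤ n
  point = List.lookup points

  point-injective : Injective _≡_ _≡_ point
  point-injective = Unique⇒lookup-injective (Unique.deduplicate-! _≟ᵥ_ S)

  point∈S : ∀ u → point u ∈ S
  point∈S u = ∈-deduplicate⁻ _≟ᵥ_ S (∈-lookup u)

  vertex : ∀ {x} → x ∈ S → Fin m
  vertex x∈S = index (∈-deduplicate⁺ _≟ᵥ_ x∈S)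

  point-vertex : ∀ {x} (x∈S : x ∈ S) → point (vertex x∈S) ≡ x
  point-vertex x∈S = sym (lookup-index (∈-deduplicate⁺ _≟ᵥ_ x∈S))

  Close : Vec ℤ n → Vec ℤ n → Set
  Close x y = ∀ j → ∣ lookup x j -ℤ lookup y j ∣ ≤ 1

  Close-sym : ∀ {x y} → Close x y → Close y x
  Close-sym {x} {y} xy j = subst (_≤ 1) (ℤ.∣i-j∣≡∣j-i∣ (lookup x j) (lookup y j)) (xy j)

  Adjacent : Fin m → Fin m → Set
  Adjacent u v = ¬ u ≡ v × Close (point u) (point v)

  adjacent? : ∀ u v → Dec (Adjacent u v)
  adjacent? u v = ¬? (u Fin.≟ v) ×-dec all? (λ j → _ ≤? 1)

  Adjacent-sym : ∀ {u v} → Adjacent u v → Adjacent v u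
  Adjacent-sym {u} {v} (u≢v , uv) = u≢v ∘ sym , Close-sym {point u} {point v} uv

  G : Graph m
  G = record
    { adj    = λ u v → does (adjacent? u v)
    ; sym    = λ u v → does-⇔ (mk⇔ Adjacent-sym Adjacent-sym) (adjacent? u v) (adjacent? v u)
    ; irrefl = λ u → dec-false (adjacent? u u) (λ (u≢u , _) → u≢u refl)
    }

  adj⇒Adjacent : ∀ {u v} → adj G u v ≡ true → Adjacent u v
  adj⇒Adjacent {u} {v} e = invert (subst (Reflects (Adjacent u v)) e (proof (adjacent? u v)))

  Adjacent⇒adj : ∀ {u v} → Adjacent u v → adj G u v ≡ true
  Adjacent⇒adj {u} {v} = dec-true (adjacent? u v)

  coordinate : Fin m → Fin n → ℕ
  coordinate u i = ∣ lookup (point u) i ∣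

  +coordinate : ∀ u i → + coordinate u i ≡ lookup (point u) i
  +coordinate u i = ℤ.0≤i⇒+∣i∣≡i (proj₁ (prop1 (point u) (point∈S u)) i)

  coordinate-adj : ∀ i {u v} → adj G u v ≡ true → coordinate u i ≤ suc (coordinate v i)
  coordinate-adj i {u} {v} e = ∣+m-+n∣≤1⇒m≤1+n _ _ (subst (λ z → ∣ z ∣ ≤ 1)
    (sym (cong₂ _-ℤ_ (+coordinate u i) (+coordinate v i))) (proj₂ (adj⇒Adjacent e) i))

  W : Fin n → Fin m
  W i with prop2 i
  ... | _ , (x∈S , _) , _ = vertex x∈S

  W-zero : ∀ i → lookup (point (W i)) i ≡ + 0
  W-zero i with prop2 i
  ... | x , (x∈S , xi≡0) , _ = trans (cong (λ y → lookup y i) (point-vertex x∈S)) xi≡0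

  zero⇒≡W : ∀ u i → lookup (point u) i ≡ + 0 → u ≡ W i
  zero⇒≡W u i ui≡0 with prop2 i
  ... | x , (x∈S , _) , unique =
    point-injective (trans (unique (point u) (point∈S u) ui≡0) (sym (point-vertex x∈S)))

  W-injective : Injective _≡_ _≡_ W
  W-injective {i} {j} Wi≡Wj = proj₂ (prop1 (point (W i)) (point∈S (W i))) i j
    (W-zero i) (subst (λ u → lookup (point u) j ≡ + 0) (sym Wi≡Wj) (W-zero j))

  coordinate≡⇒lookup≡ : ∀ {u i k} → coordinate u i ≡ k → lookup (point u) i ≡ + k
  coordinate≡⇒lookup≡ {u} {i} ui≡k = trans (sym (+coordinate u i)) (cong +_ ui≡k)

  walk-to-W : ∀ k u i → coordinate u i ≡ k → Walk G u (W i) k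
  walk-to-W zero    u i ui≡0 = subst (λ w → Walk G u w 0) (zero⇒≡W u i (coordinate≡⇒lookup≡ ui≡0)) here
  walk-to-W (suc k) u i ui≡1+k with prop3 (point u) i (point∈S u) 0<ui
    where
    0<ui : + 0 <ℤ lookup (point u) i
    0<ui = subst (+ 0 <ℤ_) (sym (coordinate≡⇒lookup≡ ui≡1+k)) (ℤ.+<+ (s≤s z≤n))
  ... | y , y∈S , yi≡ui-1 , yu = step (Adjacent⇒adj (u≢v , uv)) (walk-to-W k v i vi≡k)
    where
    v : Fin m
    v = vertex y∈S
    vi≡k : coordinate v i ≡ k
    vi≡k = cong ∣_∣ (begin
      lookup (point v) i        ≡⟨ cong (λ z → lookup z i) (point-vertex y∈S) ⟩
      lookup y i                ≡⟨ yi≡ui-1 ⟩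
      lookup (point u) i -ℤ + 1 ≡⟨ cong (_-ℤ + 1) (coordinate≡⇒lookup≡ ui≡1+k) ⟩
      + k                       ∎)
      where open ≡-Reasoning
    u≢v : ¬ u ≡ v
    u≢v u≡v = 1+n≢n (trans (sym ui≡1+k) (trans (cong (λ w → coordinate w i) u≡v) vi≡k))
    uv : Close (point u) (point v)
    uv = subst (Close (point u)) (sym (point-vertex y∈S)) (Close-sym {y} {point u} yu)

  length≥coordinate : ∀ {u i j} → Walk G u (W i) j → coordinate u i ≤ j
  length≥coordinate {u} {i} {j} uω = subst (coordinate u i ≤_)
    (trans (cong (λ c → j + ∣ c ∣) (W-zero i)) (+-identityʳ j))
    (Walk-lipschitz G (λ v → coordinate v i) (coordinate-adj i) uω)

  represents : ∀ u → IsRep G W u (point u)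
  represents u i = coordinate u i , sym (+coordinate u i) ,
    Dist-intro G (walk-to-W _ u i refl) length≥coordinate

  resolving : Resolving G W
  resolving u v x ru rv = point-injective (trans
    (IsRep-unique G W (point u) x (represents u) ru)
    (IsRep-unique G W x (point v) rv (represents v)))

  connected : Connected G
  connected with Fin-inhabited? n
  ... | yes i = connected-via G (W i) λ u → _ , walk-to-W _ u i refl
  -- without landmarks all points of S coincide
  ... | no ¬i = λ u v → 0 , subst (λ w → Walk G u w 0) (point-injective (lookup-ext (⊥-elim ∘ ¬i))) here

  realizable : Realizable n S
  realizable = m , G , W , connected , W-injective , resolving ,
    (λ x x∈S → vertex x∈S , subst (IsRep G W (vertex x∈S)) (point-vertex x∈S) (represents (vertex x∈S))) ,
    λ u → point u , point∈S u , represents u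

realizable⇒properties : ∀ n (S : List (Vec ℤ n)) → Realizable n S → Prop1 n S × Prop2 n S × Prop3 n S
realizable⇒properties n S (_ , G , W , _ , W-injective , _ , realize , represent) =
  prop1 , prop2 , prop3
  where open Necessity {S = S} G W W-injective realize represent

theorem3 : (n : ℕ) (S : List (Vec ℤ n)) →
    Realizable n S ⇔ (Prop1 n S × Prop2 n S × Prop3 n S)
theorem3 n S = mk⇔ (realizable⇒properties n S) λ (p1 , p2 , p3) → Sufficiency.realizable p1 p2 p3
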